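{- For every integer $n\ge1$, the poset $\mathcal{D}(n)$ of hyperbinary expansions of $n$ (equivalently, the poset of hyperbinary partitions of $n$ ordered by refinement) is isomorphic to the lattice $\mathcal{J}(\mathcal{F}(n))$ of lower order ideals of the fence $\mathcal{F}(n)$ ordered by inclusion.
   Context: A hyperbinary partition of $n$ is a partition of $n$ into powers of $2$ in which each part occurs at most twice. Refinement order: $\mu\le\lambda$ if the parts of $\lambda$ can be subdivided to produce the parts of $\mu$. Let $\beta(n)=b_1b_2\cdots b_k$ be the binary expansion of $n$ with $b_1=1$ the most significant digit, so $n=\sum_i b_i2^{k-i}$. A hyperbinary expansion of $n$ is a word $d=d_1\cdots d_k$ of the same length $k$ with $d_i\in\{0,1,2\}$ and $\sum_i d_i2^{k-i}=n$; it corresponds bijectively to the hyperbinary partition in which $2^{k-i}$ has multiplicity $d_i$. $\mathcal{D}(n)$ is the set of hyperbinary expansions of $n$ with the order transported from refinement of the corresponding partitions. The principal prefix of $\beta(n)$ is $b_1\cdots b_r$, where $b_{r+1}$ is the rightmost $0$ of $\beta(n)$ (if $\beta(n)$ has no $0$, the principal prefix is empty and $r=0$). The fence $\mathcal{F}(n)$ is the poset on $\{x_1,\dots,x_r\}$ whose cover relations are, for $2\le i\le r$: $x_i$ is covered by $x_{i-1}$ if $b_i=0$, and $x_i$ covers $x_{i-1}$ if $b_i=1$ (no other covers). -}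

module Defs where

open import Data.Nat using (ℕ; zero; suc; _+_; _*_; _^_; _≤_; _≡ᵇ_)
open import Data.Nat.DivMod using (_/_; _%_)
open import Data.Bool using (Bool; true; false)
open import Data.List using (List; []; _∷_; _++_; length; reverse; replicate; map; concat; foldl)
open import Data.Nat.ListAction using (sum)
open import Data.List.Relation.Unary.All using (All)
open import Data.List.Relation.Binary.Permutation.Propositional using (_↭_)
open import Data.Fin using (Fin; toℕ)
open import Data.Fin.Subset using (Subset; _∈_; _⊆_)
open import Data.List using (lookup)
open import Data.Product using (Σ; _×_; proj₁)
open import Relation.Binary.PropositionalEquality using (_≡_)
open import Relation.Binary.Construct.Closure.ReflexiveTransitive using (Star)

-- Binary expansion β(n), most significant bit first (true = 1).

-- least-significant-bit-first digits, with fuel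
bitsLSB : ℕ → ℕ → List Bool
bitsLSB zero    _       = []
bitsLSB (suc f) zero    = []
bitsLSB (suc f) (suc m) = ((suc m % 2) ≡ᵇ 1) ∷ bitsLSB f (suc m / 2)

β : ℕ → List Bool
β n = reverse (bitsLSB n n)

evalDigits : List ℕ → ℕ
evalDigits = foldl (λ acc x → 2 * acc + x) 0

HypExp : ℕ → Set
HypExp n = Σ (List ℕ) λ d →
  (length d ≡ length (β n)) × All (_≤ 2) d × (evalDigits d ≡ n)

partsOf : List ℕ → List ℕ
partsOf []       = []
partsOf (x ∷ xs) = replicate x (2 ^ length xs) ++ partsOf xs

-- refinement: μ ≤ λ iff the parts of λ can be subdivided to give the
-- parts of μ (each part of λ is replaced by a list of parts summing to it,
-- and together these lists form μ as a multiset)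
Refines : List ℕ → List ℕ → Set
Refines μ lam = Σ (List (List ℕ)) λ L → (map sum L ≡ lam) × (concat L ↭ μ)

_≤D_ : ∀ {n} → HypExp n → HypExp n → Set
d ≤D d' = Refines (partsOf (proj₁ d)) (partsOf (proj₁ d'))

-- drop the trailing 1s and the rightmost 0 (applied to the reversed word)
stripOnes : List Bool → List Bool
stripOnes []           = []
stripOnes (true ∷ xs)  = stripOnes xs
stripOnes (false ∷ xs) = xs

principalPrefix : List Bool → List Bool
principalPrefix bs = reverse (stripOnes (reverse bs))

-- cover relation of the fence on positions of p = b₁⋯b_r (0-indexed);
-- FenceCover p x y means "x is covered by y".
data FenceCover (p : List Bool) : Fin (length p) → Fin (length p) → Set where
  down : (i j : Fin (length p)) → toℕ i ≡ suc (toℕ j) →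
         lookup p i ≡ false → FenceCover p i j
  up   : (i j : Fin (length p)) → toℕ i ≡ suc (toℕ j) →
         lookup p i ≡ true → FenceCover p j i

FenceLe : (p : List Bool) → Fin (length p) → Fin (length p) → Set
FenceLe p = Star (FenceCover p)

fenceWord : ℕ → List Bool
fenceWord n = principalPrefix (β n)

IsLowerIdeal : (p : List Bool) → Subset (length p) → Set
IsLowerIdeal p I = ∀ x y → FenceLe p x y → y ∈ I → x ∈ I

Ideal : ℕ → Set
Ideal n = Σ (Subset (length (fenceWord n))) (IsLowerIdeal (fenceWord n))

_⊆J_ : ∀ {n} → Ideal n → Ideal n → Set
I ⊆J J = proj₁ I ⊆ proj₁ J

record OrderIso (n : ℕ) : Set where
  field
    to      : HypExp n → Ideal n
    from    : Ideal n → HypExp n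
    from∘to : ∀ d → proj₁ (from (to d)) ≡ proj₁ d
    to∘from : ∀ I → proj₁ (to (from I)) ≡ proj₁ I
    to-mono   : ∀ d d' → _≤D_ {n} d d' → _⊆J_ {n} (to d) (to d')
    from-mono : ∀ I J → _⊆J_ {n} I J → _≤D_ {n} (from I) (from J)

{-# OPTIONS --safe #-}

-- Let β(n) = b₁⋯b_k. A hyperbinary expansion d of n is determined by its borrows x₁, …, x_k ∈ {0, 1}:
-- position i hands x_i units of 2^(k−i) to position i + 1, where they count twice, so
-- d_i = 2x_{i−1} + b_i − x_i with x₀ = x_k = 0. The condition d_i ∈ {0, 1, 2} reads x_i ≤ x_{i−1} if b_i = 0
-- and x_{i−1} ≤ x_i if b_i = 1, i.e. the borrows are monotone along the covers of the fence; from the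
-- rightmost 0 of β(n) on they all vanish. So the borrow sets are the up-sets of 𝓕(n), the complements of
-- its lower ideals.
-- Refinement is reverse inclusion of borrow sets. One more borrow at position i splits a part 2^(k−i) into
-- two parts 2^(k−i−1); conversely x_i is read off from the total size x_i·2^(k−i) + (b_{i+1}⋯b_k)₂ of the
-- parts smaller than 2^(k−i), and that total can only grow under refinement.

module Submission where

open import Defs
open import Data.Bool using (Bool; true; false; _xor_; f≤t; b≤b) renaming (_≤_ to _≤ᵇ_)
import Data.Bool.Properties as Boolₚ
open import Data.Nat using (ℕ; zero; suc; _+_; _*_; _^_; _∸_; _≤_; _<_; _≥_; _<?_; _≡ᵇ_; z≤n; s≤s; s≤s⁻¹)
open import Data.Nat.Properties
open import Data.Nat.DivMod using (_/_; _%_; m≡m%n+[m/n]*n; m%n<n; m/n<m; m≥n⇒m/n>0)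
open import Data.Nat.ListAction using (sum)
open import Data.Nat.ListAction.Properties using (sum-++; sum-↭)
open import Algebra.Properties.CommutativeSemigroup +-commutativeSemigroup using (x∙yz≈y∙xz)
open import Data.List
  using (List; []; _∷_; _++_; [_]; _∷ʳ_; length; map; concat; filter; replicate; reverse; foldl; foldr)
open import Data.List.Properties
  using (++-identityʳ; ++-assoc; map-++; concat-++; length-map; reverse-map; reverse-foldl; reverse-++;
         reverse-involutive; unfold-reverse; filter-++; filter-all; filter-none; filter-accept; filter-reject)
open import Data.List.Relation.Unary.All as All using (All; []; _∷_)
import Data.List.Relation.Unary.All.Properties as Allₚ
import Data.List.Relation.Binary.Permutation.Propositional as ↭
open import Data.List.Relation.Binary.Permutation.Propositional using (_↭_; ↭-refl; ↭-sym; ↭-trans; ↭-reflexive)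
open import Data.List.Relation.Binary.Permutation.Propositional.Properties
  using (++⁺; ++⁺ˡ; shift; shifts; ↭-map-inv; filter-↭)
open import Data.Vec using (Vec; []; _∷_; here; there; lookup)
import Data.Vec.Properties as Vecₚ
open import Data.Fin using (zero; suc)
open import Data.Fin.Subset using (Subset; _∈_; _⊆_; ∁) renaming (⊥ to ∅)
open import Data.Fin.Subset.Properties using (⊆-refl; ⊆-antisym; drop-∷-⊆; out⊆; s⊆s; p⊆q⇒∁p⊇∁q)
open import Data.Product using (Σ-syntax; ∃; ∃-syntax; _×_; _,_; proj₁; proj₂)
open import Function using (id; _∘_)
open import Function.Bundles using (_⇔_; mk⇔; Equivalence)
open import Function.Properties.Equivalence using () renaming (trans to ⇔-trans)
open import Relation.Binary.Construct.Closure.ReflexiveTransitive using (ε; _◅_; fold)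
open import Relation.Binary.PropositionalEquality hiding ([_])
open import Relation.Nullary using (yes; no; ¬_; contradiction)

Refines-refl : ∀ xs → Refines xs xs
Refines-refl []       = [] , refl , ↭-refl
Refines-refl (x ∷ xs) with L , eq , p ← Refines-refl xs = [ x ] ∷ L , cong₂ _∷_ (+-identityʳ x) eq , ↭.prep x p

Refines-++ : ∀ {μ₁ ν₁ μ₂ ν₂} → Refines μ₁ ν₁ → Refines μ₂ ν₂ → Refines (μ₁ ++ μ₂) (ν₁ ++ ν₂)
Refines-++ (L₁ , refl , p₁) (L₂ , refl , p₂) =
  L₁ ++ L₂ , map-++ sum L₁ L₂ ,
  ↭-trans (↭-reflexive (sym (concat-++ L₁ L₂))) (++⁺ p₁ p₂)

Refines-sum : ∀ xs → Refines xs [ sum xs ]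
Refines-sum xs = [ xs ] , refl , ↭-reflexive (++-identityʳ xs)

Refines-merge : ∀ x {y μ ν} → Refines μ (y ∷ ν) → Refines (x ∷ μ) (x + y ∷ ν)
Refines-merge x ([]    , () , _)
Refines-merge x (l ∷ L , refl , p) = (x ∷ l) ∷ L , refl , ↭.prep x p

Refines-↭ˡ : ∀ {μ μ′ ν} → μ ↭ μ′ → Refines μ ν → Refines μ′ ν
Refines-↭ˡ p (L , eq , q) = L , eq , ↭-trans q p

concat-↭ : ∀ {L L′ : List (List ℕ)} → L ↭ L′ → concat L ↭ concat L′
concat-↭ ↭.refl          = ↭-refl
concat-↭ (↭.prep l p)    = ++⁺ˡ l (concat-↭ p)
concat-↭ (↭.swap l l′ p) = ↭-trans (shifts l l′) (++⁺ˡ l′ (++⁺ˡ l (concat-↭ p)))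
concat-↭ (↭.trans p q)   = ↭-trans (concat-↭ p) (concat-↭ q)

Refines-↭ʳ : ∀ {μ ν ν′} → ν ↭ ν′ → Refines μ ν → Refines μ ν′
Refines-↭ʳ p (L , refl , q) with L′ , refl , r ← ↭-map-inv sum p = L′ , refl , ↭-trans (concat-↭ (↭-sym r)) q

sumBelow : ℕ → List ℕ → ℕ
sumBelow t xs = sum (filter (_<? t) xs)

sumBelow-++ : ∀ t xs ys → sumBelow t (xs ++ ys) ≡ sumBelow t xs + sumBelow t ys
sumBelow-++ t xs ys = trans (cong sum (filter-++ (_<? t) xs ys)) (sum-++ (filter (_<? t) xs) (filter (_<? t) ys))

sumBelow-all : ∀ {t xs} → All (_< t) xs → sumBelow t xs ≡ sum xs
sumBelow-all {t} all = cong sum (filter-all (_<? t) all)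

sumBelow-none : ∀ {t xs} → All (λ x → ¬ x < t) xs → sumBelow t xs ≡ 0
sumBelow-none {t} none = cong sum (filter-none (_<? t) none)

sum<⇒All< : ∀ {t} xs → sum xs < t → All (_< t) xs
sum<⇒All< []       _ = []
sum<⇒All< (x ∷ xs) h = ≤-<-trans (m≤m+n x (sum xs)) h ∷ sum<⇒All< xs (≤-<-trans (m≤n+m (sum xs) x) h)

sumBelow-[sum] : ∀ t xs → sumBelow t [ sum xs ] ≤ sumBelow t xs
sumBelow-[sum] t xs with sum xs <? t
... | yes s<t = ≤-reflexive (trans (cong sum (filter-accept (_<? t) s<t))
                                   (trans (+-identityʳ (sum xs)) (sym (sumBelow-all (sum<⇒All< xs s<t)))))
... | no  s≮t = ≤-trans (≤-reflexive (cong sum (filter-reject (_<? t) s≮t))) z≤n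

sumBelow-↭ : ∀ t {xs ys} → xs ↭ ys → sumBelow t xs ≡ sumBelow t ys
sumBelow-↭ t p = sum-↭ (filter-↭ (_<? t) p)

sumBelow-map-sum : ∀ t L → sumBelow t (map sum L) ≤ sumBelow t (concat L)
sumBelow-map-sum t []      = z≤n
sumBelow-map-sum t (l ∷ L) = begin
  sumBelow t ([ sum l ] ++ map sum L)            ≡⟨ sumBelow-++ t [ sum l ] (map sum L) ⟩
  sumBelow t [ sum l ] + sumBelow t (map sum L)  ≤⟨ +-mono-≤ (sumBelow-[sum] t l) (sumBelow-map-sum t L) ⟩
  sumBelow t l + sumBelow t (concat L)           ≡⟨ sumBelow-++ t l (concat L) ⟨
  sumBelow t (l ++ concat L)                     ∎
  where open ≤-Reasoning

Refines-sumBelow : ∀ t {μ ν} → Refines μ ν → sumBelow t ν ≤ sumBelow t μ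
Refines-sumBelow t (L , refl , p) = ≤-trans (sumBelow-map-sum t L) (≤-reflexive (sumBelow-↭ t p))

bit : Bool → ℕ
bit false = 0
bit true  = 1

value : List ℕ → ℕ
value []       = 0
value (d ∷ ds) = d * 2 ^ length ds + value ds

valueᵇ : List Bool → ℕ
valueᵇ []       = 0
valueᵇ (b ∷ bs) = bit b * 2 ^ length bs + valueᵇ bs

carry-step : ∀ d x c b P V → x + d ≡ 2 * c + b → d * P + (x * P + V) ≡ c * (2 * P) + (b * P + V)
carry-step d x c b P V balance = begin
  d * P + (x * P + V)         ≡⟨ x∙yz≈y∙xz (d * P) (x * P) V ⟩
  x * P + (d * P + V)         ≡⟨ +-assoc (x * P) (d * P) V ⟨
  x * P + d * P + V           ≡⟨ cong (_+ V) (*-distribʳ-+ P x d) ⟨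
  (x + d) * P + V             ≡⟨ cong (λ y → y * P + V) balance ⟩
  (2 * c + b) * P + V         ≡⟨ cong (_+ V) (*-distribʳ-+ P (2 * c) b) ⟩
  2 * c * P + b * P + V       ≡⟨ +-assoc (2 * c * P) (b * P) V ⟩
  2 * c * P + (b * P + V)     ≡⟨ cong (λ y → y * P + (b * P + V)) (*-comm 2 c) ⟩
  c * 2 * P + (b * P + V)     ≡⟨ cong (_+ (b * P + V)) (*-assoc c 2 P) ⟩
  c * (2 * P) + (b * P + V)   ∎
  where open ≡-Reasoning

2^<2^suc : ∀ m → 2 ^ m < 2 ^ suc m
2^<2^suc m = ^-monoʳ-< 2 (s≤s (s≤s z≤n)) (n<1+n m)

bit≤1 : ∀ b → bit b ≤ 1
bit≤1 false = z≤n
bit≤1 true  = s≤s z≤n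

valueᵇ-< : ∀ bs → valueᵇ bs < 2 ^ length bs
valueᵇ-< []       = s≤s z≤n
valueᵇ-< (b ∷ bs) = begin-strict
  bit b * P + valueᵇ bs  <⟨ +-monoʳ-< (bit b * P) (valueᵇ-< bs) ⟩
  bit b * P + P          ≤⟨ +-monoˡ-≤ P (*-monoˡ-≤ P (bit≤1 b)) ⟩
  1 * P + P              ≡⟨ +-comm (1 * P) P ⟩
  2 * P                  ∎
  where
  open ≤-Reasoning
  P : ℕ
  P = 2 ^ length bs

value-< : ∀ {ds} → All (_≤ 2) ds → value ds < 2 * 2 ^ length ds
value-< []                       = s≤s z≤n
value-< {d ∷ ds} (d≤2 ∷ ds≤2) = begin-strict
  d * P + value ds     <⟨ +-mono-≤-< (*-monoˡ-≤ P d≤2) (value-< ds≤2) ⟩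
  2 * P + 2 * P        ≡⟨ *-distribʳ-+ P 2 2 ⟨
  4 * P                ≡⟨ *-assoc 2 2 P ⟩
  2 * (2 * P)          ∎
  where
  open ≤-Reasoning
  P : ℕ
  P = 2 ^ length ds

-- Legal c b x: at a position with bit b, incoming borrow c and outgoing borrow x,
-- the digit 2c + b − x lies in {0, 1, 2}.
Legal : Bool → Bool → Bool → Set
Legal c false x = x ≤ᵇ c
Legal c true  x = c ≤ᵇ x

digit : Bool → Bool → Bool → ℕ
digit c b x = 2 * bit c + bit b ∸ bit x

digit-balance : ∀ {c b x} → Legal c b x → bit x + digit c b x ≡ 2 * bit c + bit b
digit-balance {false} {false} {false} _ = refl
digit-balance {false} {true}  {false} _ = refl
digit-balance {false} {true}  {true}  _ = refl
digit-balance {true}  {false} {false} _ = refl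
digit-balance {true}  {false} {true}  _ = refl
digit-balance {true}  {true}  {true}  _ = refl
digit-balance {false} {false} {true}  ()
digit-balance {true}  {true}  {false} ()

digit-≤2 : ∀ {c b x} → Legal c b x → digit c b x ≤ 2
digit-≤2 {false} {false} {false} _ = z≤n
digit-≤2 {false} {true}  {false} _ = s≤s z≤n
digit-≤2 {false} {true}  {true}  _ = z≤n
digit-≤2 {true}  {false} {false} _ = s≤s (s≤s z≤n)
digit-≤2 {true}  {false} {true}  _ = s≤s z≤n
digit-≤2 {true}  {true}  {true}  _ = s≤s (s≤s z≤n)
digit-≤2 {false} {false} {true}  ()
digit-≤2 {true}  {true}  {false} ()

balance⇒Legal : ∀ {c b x d} → bit x + d ≡ 2 * bit c + bit b → d ≤ 2 → Legal c b x
balance⇒Legal {false} {false} {false} _    _ = b≤b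
balance⇒Legal {false} {false} {true}  ()   _
balance⇒Legal {false} {true}  {x}     _    _ = Boolₚ.≤-minimum x
balance⇒Legal {true}  {false} {x}     _    _ = Boolₚ.≤-maximum x
balance⇒Legal {true}  {true}  {false} refl (s≤s (s≤s ()))
balance⇒Legal {true}  {true}  {true}  _    _ = b≤b

digit-unique : ∀ {c b x d} → Legal c b x → bit x + d ≡ 2 * bit c + bit b → digit c b x ≡ d
digit-unique {x = x} legal balance = +-cancelˡ-≡ (bit x) _ _ (trans (digit-balance legal) (sym balance))

-- Carries c bs v e: v is a legal borrow vector for the bits bs, entered with borrow c and left with e.
data Carries : Bool → (bs : List Bool) → Vec Bool (length bs) → Bool → Set where
  []  : ∀ {c} → Carries c [] [] c
  _∷_ : ∀ {c b x bs v e} → Legal c b x → Carries x bs v e → Carries c (b ∷ bs) (x ∷ v) e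

digits : Bool → (bs : List Bool) → Vec Bool (length bs) → List ℕ
digits c []       []      = []
digits c (b ∷ bs) (x ∷ v) = digit c b x ∷ digits x bs v

length-digits : ∀ c bs v → length (digits c bs v) ≡ length bs
length-digits c []       []      = refl
length-digits c (b ∷ bs) (x ∷ v) = cong suc (length-digits x bs v)

digits-≤2 : ∀ {c bs v e} → Carries c bs v e → All (_≤ 2) (digits c bs v)
digits-≤2 []           = []
digits-≤2 (legal ∷ ch) = digit-≤2 legal ∷ digits-≤2 ch

value-digits : ∀ {c bs v e} → Carries c bs v e →
               bit e + value (digits c bs v) ≡ bit c * 2 ^ length bs + valueᵇ bs
value-digits {c} [] = cong (_+ 0) (sym (*-identityʳ (bit c)))
value-digits {c} {b ∷ bs} {x ∷ v} {e} (legal ∷ ch) rewrite length-digits x bs v = begin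
  bit e + (d * P + value (digits x bs v))   ≡⟨ x∙yz≈y∙xz (bit e) (d * P) (value (digits x bs v)) ⟩
  d * P + (bit e + value (digits x bs v))   ≡⟨ cong (d * P +_) (value-digits ch) ⟩
  d * P + (bit x * P + valueᵇ bs)           ≡⟨ carry-step d (bit x) (bit c) (bit b) P _ (digit-balance legal) ⟩
  bit c * (2 * P) + (bit b * P + valueᵇ bs) ∎
  where
  open ≡-Reasoning
  d : ℕ
  d = digit c b x
  P : ℕ
  P = 2 ^ length bs

leading-digit : ∀ {d t P E F} → d * P + E ≡ t * P + F → E < 2 * P → F < P →
                Σ[ x ∈ Bool ] bit x + d ≡ t × E ≡ bit x * P + F
leading-digit {zero}  {zero}        eq _ _ = false , refl , eq
leading-digit {zero}  {suc zero}    eq _ _ = true  , refl , eq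
leading-digit {zero}  {suc (suc t)} {P} {E} {F} eq E<2P _ =
  contradiction (≤-trans (*-monoˡ-≤ P (s≤s (s≤s (z≤n {t})))) (≤-trans (m≤m+n _ F) (≤-reflexive (sym eq))))
                (<⇒≱ E<2P)
leading-digit {suc d} {zero}  {P} {E} {F} eq _ F<P =
  contradiction (≤-trans (m≤m+n P (d * P)) (≤-trans (m≤m+n _ E) (≤-reflexive eq))) (<⇒≱ F<P)
leading-digit {suc d} {suc t} {P} {E} {F} eq E<2P F<P
  with x , balance , eq′ ← leading-digit {d} {t}
         (+-cancelˡ-≡ P _ _ (trans (sym (+-assoc P (d * P) E)) (trans eq (+-assoc P (t * P) F)))) E<2P F<P
  = x , trans (+-suc (bit x) d) (cong suc balance) , eq′

carries-exist : ∀ c bs ds → length ds ≡ length bs → All (_≤ 2) ds →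
                value ds ≡ bit c * 2 ^ length bs + valueᵇ bs →
                Σ[ v ∈ Vec Bool (length bs) ] Carries c bs v false × digits c bs v ≡ ds
carries-exist false []       []       _   _             _  = [] , [] , refl
carries-exist true  []       []       _   _             ()
carries-exist c     []       (_ ∷ _)  ()  _             _
carries-exist c     (_ ∷ _)  []       ()  _             _
carries-exist c     (b ∷ bs) (d ∷ ds) len (d≤2 ∷ ds≤2) eq
  = let x , balance , eq′ = leading-digit {d} eq-at-P ds-bound (valueᵇ-< bs)
        legal             = balance⇒Legal balance d≤2
        v , ch , digits≡  = carries-exist x bs ds len′ ds≤2 eq′
    in x ∷ v , legal ∷ ch , cong₂ _∷_ (digit-unique legal balance) digits≡
  where
  P : ℕ
  P = 2 ^ length bs
  len′ : length ds ≡ length bs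
  len′ = suc-injective len
  eq-at-P : d * P + value ds ≡ (2 * bit c + bit b) * P + valueᵇ bs
  eq-at-P = trans (cong (λ m → d * 2 ^ m + value ds) (sym len′))
                  (trans eq (sym (carry-step (2 * bit c + bit b) 0 (bit c) (bit b) P (valueᵇ bs) refl)))
  ds-bound : value ds < 2 * P
  ds-bound = subst (λ m → value ds < 2 * 2 ^ m) len′ (value-< ds≤2)

sum-replicate : ∀ n x → sum (replicate n x) ≡ n * x
sum-replicate zero    x = refl
sum-replicate (suc n) x = cong (x +_) (sum-replicate n x)

sum-partsOf : ∀ ds → sum (partsOf ds) ≡ value ds
sum-partsOf []       = refl
sum-partsOf (d ∷ ds) = trans (sum-++ (replicate d (2 ^ length ds)) (partsOf ds))
                             (cong₂ _+_ (sum-replicate d (2 ^ length ds)) (sum-partsOf ds))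

partsOf-< : ∀ ds → All (_< 2 ^ length ds) (partsOf ds)
partsOf-< []       = []
partsOf-< (d ∷ ds) =
  Allₚ.++⁺ (Allₚ.replicate⁺ d 2^m<2^1+m) (All.map (λ p< → <-trans p< 2^m<2^1+m) (partsOf-< ds))
  where
  2^m<2^1+m : 2 ^ length ds < 2 ^ suc (length ds)
  2^m<2^1+m = 2^<2^suc (length ds)

sumBelow-partsOf : ∀ {t} ds → 2 ^ length ds ≤ t → sumBelow t (partsOf ds) ≡ value ds
sumBelow-partsOf ds le = trans (sumBelow-all (All.map (λ p< → <-≤-trans p< le) (partsOf-< ds))) (sum-partsOf ds)

sumBelow-partsOf-∷ : ∀ {j} d ds → j ≤ length ds →
                     sumBelow (2 ^ j) (partsOf (d ∷ ds)) ≡ sumBelow (2 ^ j) (partsOf ds)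
sumBelow-partsOf-∷ {j} d ds j≤ =
  trans (sumBelow-++ (2 ^ j) (replicate d (2 ^ length ds)) (partsOf ds))
        (cong (_+ sumBelow (2 ^ j) (partsOf ds)) (sumBelow-none (Allₚ.replicate⁺ d (≤⇒≯ (^-monoʳ-≤ 2 j≤)))))

∷-⊆ : ∀ {n x′ x} {v′ v : Subset n} → x′ ≤ᵇ x → v′ ⊆ v → x′ ∷ v′ ⊆ x ∷ v
∷-⊆ f≤t = out⊆
∷-⊆ b≤b = s⊆s

⊆-head : ∀ {n x′ x} {v′ v : Subset n} → x′ ∷ v′ ⊆ x ∷ v → x′ ≤ᵇ x
⊆-head {x′ = false} {x} _ = Boolₚ.≤-minimum x
⊆-head {x′ = true} {true}  _ = b≤b
⊆-head {x′ = true} {false} sub with () ← sub here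

sumBelow-digits : ∀ {x bs v} → Carries x bs v false →
                  sumBelow (2 ^ length bs) (partsOf (digits x bs v)) ≡ bit x * 2 ^ length bs + valueᵇ bs
sumBelow-digits {x} {bs} {v} ch =
  trans (sumBelow-partsOf (digits x bs v) (≤-reflexive (cong (2 ^_) (length-digits x bs v)))) (value-digits ch)

bit-≤-cancel : ∀ {x′ x P V} → 0 < P → bit x′ * P + V ≤ bit x * P + V → x′ ≤ᵇ x
bit-≤-cancel {false} {x}   _ _ = Boolₚ.≤-minimum x
bit-≤-cancel {true}  {true} _ _ = b≤b
bit-≤-cancel {true}  {false} {P} {V} P>0 le =
  contradiction le (<⇒≱ (subst (λ Q → V < Q + V) (sym (+-identityʳ P)) (m<n+m V P>0)))

sumBelow⇒⊆ : ∀ {c c′ bs v v′} → Carries c bs v false → Carries c′ bs v′ false →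
             (∀ j → j ≤ length bs →
                sumBelow (2 ^ j) (partsOf (digits c′ bs v′)) ≤ sumBelow (2 ^ j) (partsOf (digits c bs v))) →
             v′ ⊆ v
sumBelow⇒⊆ [] [] _ = ⊆-refl
sumBelow⇒⊆ {c} {c′} {b ∷ bs} {x ∷ v} {x′ ∷ v′} (_ ∷ ch) (_ ∷ ch′) below = ∷-⊆ x′≤x (sumBelow⇒⊆ ch ch′ below′)
  where
  below′ : ∀ j → j ≤ length bs →
           sumBelow (2 ^ j) (partsOf (digits x′ bs v′)) ≤ sumBelow (2 ^ j) (partsOf (digits x bs v))
  below′ j j≤ = subst₂ _≤_ (sumBelow-partsOf-∷ (digit c′ b x′) (digits x′ bs v′) (j≤digits x′ v′))
                           (sumBelow-partsOf-∷ (digit c b x) (digits x bs v) (j≤digits x v))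
                           (below j (m≤n⇒m≤1+n j≤))
    where
    j≤digits : ∀ y w → j ≤ length (digits y bs w)
    j≤digits y w = subst (j ≤_) (sym (length-digits y bs w)) j≤
  x′≤x : x′ ≤ᵇ x
  x′≤x = bit-≤-cancel (m^n>0 2 (length bs))
                       (subst₂ _≤_ (sumBelow-digits ch′) (sumBelow-digits ch) (below′ (length bs) ≤-refl))

Refines⇒⊆ : ∀ {c c′ bs v v′} → Carries c bs v false → Carries c′ bs v′ false →
            Refines (partsOf (digits c bs v)) (partsOf (digits c′ bs v′)) → v′ ⊆ v
Refines⇒⊆ ch ch′ R = sumBelow⇒⊆ ch ch′ (λ j _ → Refines-sumBelow (2 ^ j) R)

carries-unique : ∀ {c bs v v′} → Carries c bs v false → Carries c bs v′ false →
                 digits c bs v ≡ digits c bs v′ → v ≡ v′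
carries-unique ch ch′ eq = ⊆-antisym (Refines⇒⊆ ch′ ch (refines-≡ (sym eq))) (Refines⇒⊆ ch ch′ (refines-≡ eq))
  where
  refines-≡ : ∀ {ds ds′} → ds ≡ ds′ → Refines (partsOf ds) (partsOf ds′)
  refines-≡ {ds} refl = Refines-refl (partsOf ds)

bit-xor : ∀ {x x′} → x′ ≤ᵇ x → bit x ≡ bit (x xor x′) + bit x′
bit-xor f≤t         = refl
bit-xor {false} b≤b = refl
bit-xor {true}  b≤b = refl

digit-shift : ∀ {c c′ b x x′} → Legal c b x → Legal c′ b x′ → c′ ≤ᵇ c → x′ ≤ᵇ x →
              digit c b x + bit (x xor x′) ≡ 2 * bit (c xor c′) + digit c′ b x′
digit-shift {c} {c′} {b} {x} {x′} legal legal′ c′≤c x′≤x = +-cancelʳ-≡ (bit x′) _ _ (begin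
  d + e + bit x′               ≡⟨ +-assoc d e (bit x′) ⟩
  d + (e + bit x′)             ≡⟨ cong (d +_) (bit-xor x′≤x) ⟨
  d + bit x                    ≡⟨ +-comm d (bit x) ⟩
  bit x + d                    ≡⟨ digit-balance legal ⟩
  2 * bit c + bit b            ≡⟨ cong (λ y → 2 * y + bit b) (bit-xor c′≤c) ⟩
  2 * (f + bit c′) + bit b     ≡⟨ cong (_+ bit b) (*-distribˡ-+ 2 f (bit c′)) ⟩
  2 * f + 2 * bit c′ + bit b   ≡⟨ +-assoc (2 * f) (2 * bit c′) (bit b) ⟩
  2 * f + (2 * bit c′ + bit b) ≡⟨ cong (2 * f +_) (digit-balance legal′) ⟨
  2 * f + (bit x′ + d′)        ≡⟨ cong (2 * f +_) (+-comm (bit x′) d′) ⟩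
  2 * f + (d′ + bit x′)        ≡⟨ +-assoc (2 * f) d′ (bit x′) ⟨
  2 * f + d′ + bit x′          ∎)
  where
  open ≡-Reasoning
  d : ℕ
  d = digit c b x
  d′ : ℕ
  d′ = digit c′ b x′
  e : ℕ
  e = bit (x xor x′)
  f : ℕ
  f = bit (c xor c′)

-- The a parts P on the left, together with the e parts P refined by T, make up the a′ parts P
-- and the f parts 2P = P + P on the right.
Refines-level : ∀ P {a a′ T T′} (e f : Bool) → a + bit e ≡ 2 * bit f + a′ →
                Refines T (replicate (bit e) P ++ T′) →
                Refines (replicate a P ++ T) (replicate (bit f) (2 * P) ++ replicate a′ P ++ T′)
Refines-level P {a} false false eq R with refl ← trans (sym (+-identityʳ a)) eq =
  Refines-++ (Refines-refl (replicate a P)) R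
Refines-level P {a} true  false eq R with refl ← trans (+-comm 1 a) eq =
  Refines-↭ʳ (shift P (replicate a P) _) (Refines-++ (Refines-refl (replicate a P)) R)
Refines-level P {a} false true  eq R with refl ← trans (sym (+-identityʳ a)) eq =
  Refines-++ (Refines-sum (P ∷ P ∷ [])) (Refines-++ (Refines-refl _) R)
Refines-level P {a} {a′} {T} {T′} true true eq R with refl ← suc-injective (trans (+-comm 1 a) eq) =
  Refines-↭ˡ (shift P (replicate a′ P) T) (Refines-↭ʳ (shift (2 * P) (replicate a′ P) T′)
    (Refines-++ (Refines-refl (replicate a′ P))
                (subst (λ Q → Refines (P ∷ T) (Q ∷ T′)) P+P≡2P (Refines-merge P R))))
  where
  P+P≡2P : P + P ≡ 2 * P
  P+P≡2P = cong (P +_) (sym (+-identityʳ P))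

⊆⇒Refines : ∀ {c c′ bs v v′} → Carries c bs v false → Carries c′ bs v′ false → c′ ≤ᵇ c → v′ ⊆ v →
            Refines (partsOf (digits c bs v))
                    (replicate (bit (c xor c′)) (2 ^ length bs) ++ partsOf (digits c′ bs v′))
⊆⇒Refines [] [] _ _ = Refines-refl []
⊆⇒Refines {c} {c′} {b ∷ bs} {x ∷ v} {x′ ∷ v′} (legal ∷ ch) (legal′ ∷ ch′) c′≤c sub
  rewrite length-digits x bs v | length-digits x′ bs v′ =
  Refines-level (2 ^ length bs) (x xor x′) (c xor c′) (digit-shift legal legal′ c′≤c x′≤x)
                (⊆⇒Refines ch ch′ x′≤x (drop-∷-⊆ sub))
  where
  x′≤x : x′ ≤ᵇ x
  x′≤x = ⊆-head sub

∈∁⇒≡false : ∀ {n} (v : Subset n) i → i ∈ ∁ v → lookup v i ≡ false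
∈∁⇒≡false (false ∷ v) zero    here      = refl
∈∁⇒≡false (true  ∷ v) zero    ()
∈∁⇒≡false (x ∷ v)     (suc i) (there h) = ∈∁⇒≡false v i h

≡false⇒∈∁ : ∀ {n} (v : Subset n) i → lookup v i ≡ false → i ∈ ∁ v
≡false⇒∈∁ (false ∷ v) zero    refl = here
≡false⇒∈∁ (x ∷ v)     (suc i) eq   = there (≡false⇒∈∁ v i eq)

∁-involutive : ∀ {n} (v : Subset n) → ∁ (∁ v) ≡ v
∁-involutive []      = refl
∁-involutive (x ∷ v) = cong₂ _∷_ (Boolₚ.not-involutive x) (∁-involutive v)

≤ᵇ-false : ∀ {a b} → a ≤ᵇ b → b ≡ false → a ≡ false
≤ᵇ-false b≤b eq = eq
≤ᵇ-false f≤t ()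

Monotone : (p : List Bool) → Subset (length p) → Set
Monotone p v = ∀ {i j} → FenceCover p i j → lookup v i ≤ᵇ lookup v j

Monotone⇔lowerIdeal : ∀ p v → Monotone p v ⇔ IsLowerIdeal p (∁ v)
Monotone⇔lowerIdeal p v = mk⇔ to from
  where
  to : Monotone p v → IsLowerIdeal p (∁ v)
  to mono _ _ = fold (λ i j → j ∈ ∁ v → i ∈ ∁ v) (λ cover next → step cover ∘ next) id
    where
    step : ∀ {i j} → FenceCover p i j → j ∈ ∁ v → i ∈ ∁ v
    step {i} {j} cover j∈ = ≡false⇒∈∁ v i (≤ᵇ-false (mono cover) (∈∁⇒≡false v j j∈))
  from : IsLowerIdeal p (∁ v) → Monotone p v
  from ideal {i} {j} cover with lookup v j in eq
  ... | true  = Boolₚ.≤-maximum _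
  ... | false = Boolₚ.≤-reflexive (∈∁⇒≡false v i (ideal i j (cover ◅ ε) (≡false⇒∈∁ v j eq)))

lift-cover : ∀ {b p i j} → FenceCover p i j → FenceCover (b ∷ p) (suc i) (suc j)
lift-cover (down i j eq pe) = down (suc i) (suc j) (cong suc eq) pe
lift-cover (up   i j eq pe) = up   (suc i) (suc j) (cong suc eq) pe

Monotone-head : ∀ {b b′ p x y v} → Monotone (b ∷ b′ ∷ p) (x ∷ y ∷ v) → Legal x b′ y
Monotone-head {b′ = false} mono = mono (down (suc zero) zero refl refl)
Monotone-head {b′ = true}  mono = mono (up   (suc zero) zero refl refl)

Monotone-∷ : ∀ {b b′ p x y v} → Legal x b′ y → Monotone (b′ ∷ p) (y ∷ v) → Monotone (b ∷ b′ ∷ p) (x ∷ y ∷ v)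
Monotone-∷ legal mono (down (suc zero)    zero    _  refl) = legal
Monotone-∷ legal mono (up   (suc zero)    zero    _  refl) = legal
Monotone-∷ legal mono (down (suc (suc i)) (suc j) eq pe)   = mono (down (suc i) j (suc-injective eq) pe)
Monotone-∷ legal mono (up   (suc (suc i)) (suc j) eq pe)   = mono (up   (suc i) j (suc-injective eq) pe)
Monotone-∷ _ _ (down zero              _       () _)
Monotone-∷ _ _ (down (suc zero)        (suc _) () _)
Monotone-∷ _ _ (down (suc (suc _))     zero    () _)
Monotone-∷ _ _ (up   zero              _       () _)
Monotone-∷ _ _ (up   (suc zero)        (suc _) () _)
Monotone-∷ _ _ (up   (suc (suc _))     zero    () _)

carries⇔Monotone : ∀ {b x} p v → ∃ (Carries x p v) ⇔ Monotone (b ∷ p) (x ∷ v)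
carries⇔Monotone {b} {x} [] [] = mk⇔ no-covers (λ _ → x , [])
  where
  no-covers : ∃ (Carries x [] []) → Monotone (b ∷ []) (x ∷ [])
  no-covers _ (down zero zero () _)
  no-covers _ (up   zero zero () _)
carries⇔Monotone {b} {x} (b′ ∷ p) (y ∷ v) = mk⇔ to from
  where
  to : ∃ (Carries x (b′ ∷ p) (y ∷ v)) → Monotone (b ∷ b′ ∷ p) (x ∷ y ∷ v)
  to (e , legal ∷ ch) = Monotone-∷ legal (Equivalence.to (carries⇔Monotone p v) (e , ch))
  from : Monotone (b ∷ b′ ∷ p) (x ∷ y ∷ v) → ∃ (Carries x (b′ ∷ p) (y ∷ v))
  from mono = let e , ch = Equivalence.from (carries⇔Monotone p v) (λ cover → mono (lift-cover cover))
              in e , Monotone-head mono ∷ ch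

prefix-carries⇔ideal : ∀ p {z rest} → p ++ z ≡ true ∷ rest → ∀ v → ∃ (Carries false p v) ⇔ IsLowerIdeal p (∁ v)
prefix-carries⇔ideal []          _    []      = mk⇔ (λ _ ()) (λ _ → false , [])
prefix-carries⇔ideal (true ∷ p)  refl (x ∷ v) =
  ⇔-trans (mk⇔ (λ { (e , _ ∷ ch) → e , ch }) (λ { (e , ch) → e , Boolₚ.≤-minimum x ∷ ch }))
          (⇔-trans (carries⇔Monotone p v) (Monotone⇔lowerIdeal (true ∷ p) (x ∷ v)))
prefix-carries⇔ideal (false ∷ p) ()

-- Vector append indexed by length (p ++ z), which does not reduce to length p + length z.
append : ∀ {A : Set} (p z : List Bool) → Vec A (length p) → Vec A (length z) → Vec A (length (p ++ z))
append []      z []      u = u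
append (b ∷ p) z (x ∷ v) u = x ∷ append p z v u

append-injectiveˡ : ∀ {A : Set} (p z : List Bool) {v v′ : Vec A (length p)} {u u′} →
                    append p z v u ≡ append p z v′ u′ → v ≡ v′
append-injectiveˡ []      z {[]}    {[]}     _  = refl
append-injectiveˡ (b ∷ p) z {x ∷ v} {x′ ∷ v′} eq with refl , eq′ ← Vecₚ.∷-injective eq =
  cong (x ∷_) (append-injectiveˡ p z eq′)

append-⊆ : ∀ (p z : List Bool) {v v′ : Subset (length p)} {u} → v′ ⊆ v → append p z v′ u ⊆ append p z v u
append-⊆ []      z {[]}    {[]}      _   = ⊆-refl
append-⊆ (b ∷ p) z {x ∷ v} {x′ ∷ v′} sub = ∷-⊆ (⊆-head sub) (append-⊆ p z (drop-∷-⊆ sub))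

append-⊆⁻ : ∀ (p z : List Bool) {v v′ : Subset (length p)} {u u′} →
            append p z v′ u′ ⊆ append p z v u → v′ ⊆ v
append-⊆⁻ []      z {[]}    {[]}      _   = ⊆-refl
append-⊆⁻ (b ∷ p) z {x ∷ v} {x′ ∷ v′} sub = ∷-⊆ (⊆-head sub) (append-⊆⁻ p z (drop-∷-⊆ sub))

Carries-++ : ∀ {c p z v u e f} → Carries c p v e → Carries e z u f → Carries c (p ++ z) (append p z v u) f
Carries-++ []           chz = chz
Carries-++ (legal ∷ ch) chz = legal ∷ Carries-++ ch chz

Carries-split : ∀ {c f} (p z : List Bool) {w} → Carries c (p ++ z) w f →
                Σ[ v ∈ Vec Bool (length p) ] Σ[ u ∈ Vec Bool (length z) ] Σ[ e ∈ Bool ]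
                  w ≡ append p z v u × Carries c p v e × Carries e z u f
Carries-split []      z ch = [] , _ , _ , refl , [] , ch
Carries-split (b ∷ p) z {x ∷ w} (legal ∷ ch) with Carries-split p z {w} ch
... | v , u , e , refl , chp , chz = x ∷ v , u , e , refl , legal ∷ chp , chz

data PrincipalSuffix : List Bool → List Bool → Set where
  all-ones  : ∀ t → PrincipalSuffix [] (replicate t true)
  zero-ones : ∀ {p} t → PrincipalSuffix p (false ∷ replicate t true)

carries-on-ones : ∀ t {e u} → Carries e (replicate t true) u false → e ≡ false × u ≡ ∅
carries-on-ones zero    []           = refl , refl
carries-on-ones (suc t) (legal ∷ ch) with carries-on-ones t ch
... | refl , refl with legal
...   | b≤b = refl , refl

∅-carries-on-ones : ∀ t → Carries false (replicate t true) ∅ false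
∅-carries-on-ones zero    = []
∅-carries-on-ones (suc t) = b≤b ∷ ∅-carries-on-ones t

suffix-carries : ∀ {p z v e} → PrincipalSuffix p z → Carries false p v e → ∀ u → Carries e z u false ⇔ u ≡ ∅
suffix-carries (all-ones t) [] u = mk⇔ (proj₂ ∘ carries-on-ones t) (λ { refl → ∅-carries-on-ones t })
suffix-carries {e = e} (zero-ones t) _ u = mk⇔ forced (λ { refl → Boolₚ.≤-minimum e ∷ ∅-carries-on-ones t })
  where
  forced : Carries e (false ∷ replicate t true) u false → u ≡ ∅
  forced (_ ∷ ch) with refl , refl ← carries-on-ones t ch = refl

replicate-∷ʳ : ∀ {A : Set} t (x : A) → replicate t x ∷ʳ x ≡ x ∷ replicate t x
replicate-∷ʳ zero    x = refl
replicate-∷ʳ (suc t) x = cong (x ∷_) (replicate-∷ʳ t x)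

PrincipalSuffix-∷ʳ : ∀ {p z} → PrincipalSuffix p z → PrincipalSuffix p (z ∷ʳ true)
PrincipalSuffix-∷ʳ (all-ones t)  = subst (PrincipalSuffix []) (sym (replicate-∷ʳ t true)) (all-ones (suc t))
PrincipalSuffix-∷ʳ (zero-ones t) =
  subst (λ w → PrincipalSuffix _ (false ∷ w)) (sym (replicate-∷ʳ t true)) (zero-ones (suc t))

stripOnes-split : ∀ rs →
                  ∃[ z ] reverse rs ≡ reverse (stripOnes rs) ++ z × PrincipalSuffix (reverse (stripOnes rs)) z
stripOnes-split []           = [] , refl , all-ones 0
stripOnes-split (false ∷ rs) = false ∷ [] , unfold-reverse false rs , zero-ones 0
stripOnes-split (true ∷ rs) with z , eq , suffix ← stripOnes-split rs =
  z ∷ʳ true ,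
  trans (unfold-reverse true rs) (trans (cong (_∷ʳ true) eq) (++-assoc (reverse (stripOnes rs)) z [ true ])) ,
  PrincipalSuffix-∷ʳ suffix

principal-split : ∀ bs → ∃[ z ] bs ≡ principalPrefix bs ++ z × PrincipalSuffix (principalPrefix bs) z
principal-split bs =
  let z , eq , suffix = stripOnes-split (reverse bs) in z , trans (sym (reverse-involutive bs)) eq , suffix

valueᵇ-value : ∀ bs → valueᵇ bs ≡ value (map bit bs)
valueᵇ-value []       = refl
valueᵇ-value (b ∷ bs) = cong₂ (λ m r → bit b * 2 ^ m + r) (sym (length-map bit bs)) (valueᵇ-value bs)

foldl-value : ∀ a ds → foldl (λ acc d → 2 * acc + d) a ds ≡ a * 2 ^ length ds + value ds
foldl-value a []       = sym (trans (+-identityʳ (a * 1)) (*-identityʳ a))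
foldl-value a (d ∷ ds) =
  trans (foldl-value (2 * a + d) ds) (carry-step (2 * a + d) 0 a d (2 ^ length ds) (value ds) refl)

evalDigits≡value : ∀ ds → evalDigits ds ≡ value ds
evalDigits≡value = foldl-value 0

valueLSB : List Bool → ℕ
valueLSB bs = foldr (λ d acc → 2 * acc + d) 0 (map bit bs)

valueᵇ-reverse : ∀ bs → valueᵇ (reverse bs) ≡ valueLSB bs
valueᵇ-reverse bs = begin
  valueᵇ (reverse bs)                ≡⟨ valueᵇ-value (reverse bs) ⟩
  value (map bit (reverse bs))       ≡⟨ evalDigits≡value (map bit (reverse bs)) ⟨
  evalDigits (map bit (reverse bs))  ≡⟨ cong evalDigits (reverse-map bit bs) ⟩
  evalDigits (reverse (map bit bs))  ≡⟨ reverse-foldl (λ acc d → 2 * acc + d) 0 (map bit bs) ⟩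
  valueLSB bs                        ∎
  where open ≡-Reasoning

half≤ : ∀ m → suc m / 2 ≤ m
half≤ m = s≤s⁻¹ (m/n<m (suc m) 2 (s≤s (s≤s z≤n)))

bit-parity : ∀ {r} → r < 2 → bit (r ≡ᵇ 1) ≡ r
bit-parity {zero}     _ = refl
bit-parity {suc zero} _ = refl
bit-parity {suc (suc r)} (s≤s (s≤s ()))

valueLSB-bitsLSB : ∀ f m → m ≤ f → valueLSB (bitsLSB f m) ≡ m
valueLSB-bitsLSB zero    zero    _         = refl
valueLSB-bitsLSB (suc f) zero    _         = refl
valueLSB-bitsLSB (suc f) (suc m) (s≤s m≤f) = begin
  2 * valueLSB (bitsLSB f q) + bit (r ≡ᵇ 1)  ≡⟨ cong₂ (λ a b → 2 * a + b)
                                                       (valueLSB-bitsLSB f q (≤-trans (half≤ m) m≤f))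
                                                       (bit-parity (m%n<n (suc m) 2)) ⟩
  2 * q + r                                 ≡⟨ +-comm (2 * q) r ⟩
  r + 2 * q                                 ≡⟨ cong (r +_) (*-comm 2 q) ⟩
  r + q * 2                                 ≡⟨ m≡m%n+[m/n]*n (suc m) 2 ⟨
  suc m                                     ∎
  where
  open ≡-Reasoning
  q : ℕ
  q = suc m / 2
  r : ℕ
  r = suc m % 2

valueᵇ-β : ∀ n → valueᵇ (β n) ≡ n
valueᵇ-β n = trans (valueᵇ-reverse (bitsLSB n n)) (valueLSB-bitsLSB n n ≤-refl)

bitsLSB-zero : ∀ f → bitsLSB f 0 ≡ []
bitsLSB-zero zero    = refl
bitsLSB-zero (suc f) = refl

bitsLSB-last : ∀ f m → 0 < m → m ≤ f → ∃[ xs ] bitsLSB f m ≡ xs ∷ʳ true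
bitsLSB-last (suc f) (suc zero)    _ _         = [] , cong (true ∷_) (bitsLSB-zero f)
bitsLSB-last (suc f) (suc (suc m)) _ (s≤s m≤f) =
  let xs , eq = bitsLSB-last f (suc (suc m) / 2) (m≥n⇒m/n>0 {suc (suc m)} (s≤s (s≤s z≤n)))
                                                (≤-trans (half≤ (suc m)) m≤f)
  in _ ∷ xs , cong (_ ∷_) eq

β-head : ∀ {n} → n ≥ 1 → ∃[ rest ] β n ≡ true ∷ rest
β-head {n} n≥1 =
  let xs , eq = bitsLSB-last n n n≥1 ≤-refl in reverse xs , trans (cong reverse eq) (reverse-++ xs [ true ])

module _ (n : ℕ) (z : List Bool) (β≡ : β n ≡ fenceWord n ++ z)
         (prefix : ∀ v → ∃ (Carries false (fenceWord n) v) ⇔ IsLowerIdeal (fenceWord n) (∁ v))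
         (suffix : ∀ {v e} → Carries false (fenceWord n) v e → ∀ u → Carries e z u false ⇔ u ≡ ∅) where

  private
    p : List Bool
    p = fenceWord n
    B : List Bool
    B = p ++ z

  padded : Subset (length p) → Vec Bool (length B)
  padded v = append p z v ∅

  padded-carries : ∀ {v} → ∃ (Carries false p v) → Carries false B (padded v) false
  padded-carries (e , ch) = Carries-++ ch (Equivalence.from (suffix ch ∅) refl)

  expansion : ∀ {w} → Carries false B w false → HypExp n
  expansion {w} ch =
    digits false B w , trans (length-digits false B w) (cong length (sym β≡)) , digits-≤2 ch , (begin
      evalDigits (digits false B w)  ≡⟨ evalDigits≡value (digits false B w) ⟩
      value (digits false B w)       ≡⟨ value-digits ch ⟩
      valueᵇ B                       ≡⟨ cong valueᵇ β≡ ⟨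
      valueᵇ (β n)                   ≡⟨ valueᵇ-β n ⟩
      n                              ∎)
    where open ≡-Reasoning

  record Borrowing (ds : List ℕ) : Set where
    field
      borrows : Subset (length p)
      prefix-carries : ∃ (Carries false p borrows)
      digits≡ : digits false B (padded borrows) ≡ ds

  borrowing : (d : HypExp n) → Borrowing (proj₁ d)
  borrowing (ds , len , ds≤2 , val)
    with w , ch , digits≡ ← carries-exist false B ds (trans len (cong length β≡)) ds≤2
                               (trans (sym (evalDigits≡value ds))
                                      (trans val (trans (sym (valueᵇ-β n)) (cong valueᵇ β≡))))
    with v , u , e , refl , chp , chz ← Carries-split p z ch
    with refl ← Equivalence.to (suffix chp u) chz
    = record { borrows = v ; prefix-carries = e , chp ; digits≡ = digits≡ }

  ideal-carries : (I : Ideal n) → Carries false B (padded (∁ (proj₁ I))) false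
  ideal-carries (I , ideal) =
    padded-carries (Equivalence.from (prefix (∁ I)) (subst (IsLowerIdeal p) (sym (∁-involutive I)) ideal))

  orderIso : OrderIso n
  orderIso = record
    { to        = to
    ; from      = from
    ; from∘to   = from∘to
    ; to∘from   = to∘from
    ; to-mono   = to-mono
    ; from-mono = from-mono
    }
    where
    to : HypExp n → Ideal n
    to d = ∁ borrows , Equivalence.to (prefix borrows) prefix-carries
      where open Borrowing (borrowing d)

    from : Ideal n → HypExp n
    from I = expansion (ideal-carries I)

    from∘to : ∀ d → proj₁ (from (to d)) ≡ proj₁ d
    from∘to d = trans (cong (digits false B ∘ padded) (∁-involutive borrows)) digits≡
      where open Borrowing (borrowing d)

    to∘from : ∀ I → proj₁ (to (from I)) ≡ proj₁ I
    to∘from (I , ideal) = trans (cong ∁ borrows≡) (∁-involutive I)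
      where
      open Borrowing (borrowing (from (I , ideal)))
      borrows≡ : borrows ≡ ∁ I
      borrows≡ = append-injectiveˡ p z
                   (carries-unique (padded-carries prefix-carries) (ideal-carries (I , ideal)) digits≡)

    to-mono : ∀ d d′ → _≤D_ {n} d d′ → _⊆J_ {n} (to d) (to d′)
    to-mono d d′ R = p⊆q⇒∁p⊇∁q (append-⊆⁻ p z (Refines⇒⊆ (padded-carries (prefix-carries D))
                                                          (padded-carries (prefix-carries D′)) R′))
      where
      open Borrowing
      D : Borrowing (proj₁ d)
      D = borrowing d
      D′ : Borrowing (proj₁ d′)
      D′ = borrowing d′
      R′ : Refines (partsOf (digits false B (padded (borrows D))))
                   (partsOf (digits false B (padded (borrows D′))))
      R′ = subst₂ (λ ds ds′ → Refines (partsOf ds) (partsOf ds′)) (sym (digits≡ D)) (sym (digits≡ D′)) R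

    from-mono : ∀ I J → _⊆J_ {n} I J → _≤D_ {n} (from I) (from J)
    from-mono I J I⊆J = ⊆⇒Refines (ideal-carries I) (ideal-carries J) b≤b (append-⊆ p z (p⊆q⇒∁p⊇∁q I⊆J))

theorem3p16 : (n : ℕ) → n ≥ 1 → OrderIso n
theorem3p16 n n≥1
  with z , β≡ , suffix ← principal-split (β n)
  with rest , β≡1∷rest ← β-head n≥1
  = orderIso n z β≡ (prefix-carries⇔ideal (fenceWord n) (trans (sym β≡) β≡1∷rest)) (suffix-carries suffix)
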